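{- For integers $2\leq k\leq n$, $D(n,k)=(k-1)D(n-1,k)+kD(n-1,k-1)$. In addition, $D(n,n)=n!$ for all $n\ge 0$, $D(n,1)=0$ for $n>1$, and $D(n,k)=0$ for $k>n$.
   Context: A walk of length $n-1$ in a graph is a sequence of $n$ vertices $v_1,\dots,v_n$ such that $\{v_i,v_{i+1}\}$ is an edge for every $i$. $D(n,k)$ denotes the number of walks of length $n-1$ in the complete graph $K_k$ on $k$ vertices (no self-loops) that visit every vertex of $K_k$ at least once (with $D(0,0)=1$, counting the empty walk in the empty graph). -}

module Defs where

open import Data.Nat using (ℕ; zero; suc)
open import Data.Fin using (Fin)
open import Data.Fin.Properties using (_≟_)
open import Data.Vec using (Vec; []; _∷_)
open import Data.Vec.Membership.Propositional using (_∈_)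
open import Data.Vec.Membership.Propositional.Properties using ()
open import Data.Vec.Relation.Unary.Any using (any?)
open import Data.List using (List; []; _∷_; concatMap; map; filter; length; allFin)
open import Data.Unit using (⊤; tt)
open import Data.Product using (_×_; _,_)
open import Relation.Binary.PropositionalEquality using (_≡_)
open import Relation.Nullary using (¬_; Dec; yes; no)
open import Relation.Nullary.Decidable using (_×-dec_; ¬?)
open import Data.Fin.Properties using (all?)

-- A sequence of vertices v₁,…,vₙ of K_k (vertices = Fin k) is a walk iff
-- consecutive vertices are adjacent, i.e. distinct (K_k has no self-loops).
IsWalk : ∀ {k n} → Vec (Fin k) n → Set
IsWalk [] = ⊤
IsWalk (x ∷ []) = ⊤
IsWalk (x ∷ y ∷ xs) = (¬ x ≡ y) × IsWalk (y ∷ xs)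

VisitsAll : ∀ {k n} → Vec (Fin k) n → Set
VisitsAll {k} xs = (v : Fin k) → v ∈ xs

isWalk? : ∀ {k n} (xs : Vec (Fin k) n) → Dec (IsWalk xs)
isWalk? [] = yes tt
isWalk? (x ∷ []) = yes tt
isWalk? (x ∷ y ∷ xs) = ¬? (x ≟ y) ×-dec isWalk? (y ∷ xs)

visitsAll? : ∀ {k n} (xs : Vec (Fin k) n) → Dec (VisitsAll xs)
visitsAll? xs = all? (λ v → any? (v ≟_) xs)

allSeqs : (k n : ℕ) → List (Vec (Fin k) n)
allSeqs k zero = [] ∷ []
allSeqs k (suc n) =
  concatMap (λ xs → map (_∷ xs) (allFin k)) (allSeqs k n)

-- D(n,k): number of walks with n vertices (length n-1) in K_k visiting
-- every vertex at least once.
D : ℕ → ℕ → ℕ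
D n k = length (filter (λ xs → isWalk? xs ×-dec visitsAll? xs) (allSeqs k n))

-- Sort the surjective walks x ∷ xs on K_k by the tail xs. If the first vertex
-- x is visited again later, xs is itself a surjective walk and x can be any of
-- the k - 1 vertices other than the first vertex of xs. Otherwise xs is a walk
-- visiting exactly the vertices other than x, and punching x out turns these
-- into the surjective walks on K_(k-1); there are k choices of x. Both base
-- cases and the vanishing statements then follow from the recurrence.
module Submission where

open import Defs
open import Data.Nat using (ℕ; suc; _+_; _*_; _∸_; _≤_; _<_)
open import Data.Nat using (_!)
open import Data.Product using (_×_)
open import Relation.Binary.PropositionalEquality using (_≡_)

open import Data.Nat using (zero; s≤s)
open import Data.Nat.Properties using (+-*-semiring; *-zeroʳ; *-identityʳ; +-identityʳ; ≤-refl; m≤n⇒m≤1+n)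
open import Data.Nat.ListAction using () renaming (sum to listSum)
open import Data.Nat.ListAction.Properties using () renaming (sum-++ to listSum-++)
open import Algebra.Properties.Semiring.Sum +-*-semiring
  using (sum; sum-syntax; sum-cong-≗; sum-replicate-zero; sum-remove; ∑-distrib-+; ∑-comm; *-distribˡ-sum; *-distribʳ-sum)
open import Data.Fin using (Fin; zero; suc; punchIn)
open import Data.Fin.Properties using (_≟_; all?; punchIn-injective; punchInᵢ≢i; punchIn-punchOut)
open import Data.Vec using (Vec; []; _∷_) renaming (map to mapⱽ)
open import Data.Vec.Membership.Propositional using (_∈_; _∉_)
open import Data.Vec.Membership.Propositional.Properties using (∈-map⁺)
open import Data.Vec.Relation.Unary.Any using (here; there; any?; satisfied) renaming (map to mapᴬ)
open import Data.Vec.Relation.Unary.Any.Properties using (map⁻)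
open import Data.List using (List; []; _∷_; _++_; map; filter; length; allFin; concatMap; tabulate)
open import Data.List.Properties using (map-++; map-cong; map-tabulate)
open import Data.Unit using (⊤; tt)
open import Data.Sum using (_⊎_; inj₁; inj₂)
open import Data.Product using (_,_)
open import Function using (_∘_; id; _⇔_; mk⇔)
open import Function.Bundles using (module Equivalence)
open import Relation.Binary.PropositionalEquality using (_≢_; refl; sym; trans; cong; cong₂; subst; _≗_; module ≡-Reasoning)
open import Relation.Nullary using (¬_; Dec; yes; no; contradiction)
open import Relation.Nullary.Decidable using (_×-dec_; _⊎-dec_; _→-dec_; ¬?)

private
  variable
    k m n : ℕ

𝟙 : {P : Set} → Dec P → ℕ
𝟙 (yes _) = 1
𝟙 (no _)  = 0

𝟙-no : {P : Set} → ¬ P → (p : Dec P) → 𝟙 p ≡ 0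
𝟙-no ¬p (yes p) = contradiction p ¬p
𝟙-no ¬p (no _)  = refl

𝟙-yes : {P : Set} → P → (p : Dec P) → 𝟙 p ≡ 1
𝟙-yes p (yes _) = refl
𝟙-yes p (no ¬p) = contradiction p ¬p

𝟙-cong : {P Q : Set} → P ⇔ Q → (p : Dec P) (q : Dec Q) → 𝟙 p ≡ 𝟙 q
𝟙-cong P⇔Q (yes p) q = sym (𝟙-yes (Equivalence.to P⇔Q p) q)
𝟙-cong P⇔Q (no ¬p) q = sym (𝟙-no (¬p ∘ Equivalence.from P⇔Q) q)

𝟙-× : {P Q : Set} (p : Dec P) (q : Dec Q) → 𝟙 (p ×-dec q) ≡ 𝟙 p * 𝟙 q
𝟙-× (yes _) (yes _) = refl
𝟙-× (yes _) (no _)  = refl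
𝟙-× (no _)  _       = refl

𝟙-⊎ : {P Q : Set} → ¬ (P × Q) → (p : Dec P) (q : Dec Q) → 𝟙 (p ⊎-dec q) ≡ 𝟙 p + 𝟙 q
𝟙-⊎ disjoint (yes p) (yes q) = contradiction (p , q) disjoint
𝟙-⊎ disjoint (yes _) (no _)  = refl
𝟙-⊎ disjoint (no _)  (yes _) = refl
𝟙-⊎ disjoint (no _)  (no _)  = refl

length-filter : {A : Set} {P : A → Set} (P? : ∀ x → Dec (P x)) (xs : List A) →
                length (filter P? xs) ≡ listSum (map (𝟙 ∘ P?) xs)
length-filter P? []       = refl
length-filter P? (x ∷ xs) with P? x
... | yes _ = cong suc (length-filter P? xs)
... | no _  = length-filter P? xs

∑-const : ∀ k c → ∑[ _ < k ] c ≡ k * c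
∑-const zero    c = refl
∑-const (suc k) c = cong (c +_) (∑-const k c)

∑-≢ : (y : Fin (suc m)) → ∑[ x < suc m ] 𝟙 (¬? (x ≟ y)) ≡ m
∑-≢ {m} y = begin
  ∑[ x < suc m ] 𝟙 (¬? (x ≟ y))
    ≡⟨ sum-remove {i = y} (λ x → 𝟙 (¬? (x ≟ y))) ⟩
  𝟙 (¬? (y ≟ y)) + ∑[ x < m ] 𝟙 (¬? (punchIn y x ≟ y))
    ≡⟨ cong₂ _+_ (𝟙-no (λ y≢y → y≢y refl) _) (sum-cong-≗ (λ x → 𝟙-yes (punchInᵢ≢i y x) _)) ⟩
  ∑[ _ < m ] 1
    ≡⟨ trans (∑-const m 1) (*-identityʳ m) ⟩
  m ∎
  where open ≡-Reasoning

∑ⱽ : ∀ k n → (Vec (Fin k) n → ℕ) → ℕ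
∑ⱽ k zero    f = f []
∑ⱽ k (suc n) f = ∑ⱽ k n (λ xs → ∑[ x < k ] f (x ∷ xs))

∑ⱽ-cong : ∀ n {f g : Vec (Fin k) n → ℕ} → f ≗ g → ∑ⱽ k n f ≡ ∑ⱽ k n g
∑ⱽ-cong zero    f≗g = f≗g []
∑ⱽ-cong (suc n) f≗g = ∑ⱽ-cong n (λ xs → sum-cong-≗ (λ x → f≗g (x ∷ xs)))

∑ⱽ-zero : ∀ n → ∑ⱽ k n (λ _ → 0) ≡ 0
∑ⱽ-zero {k} zero    = refl
∑ⱽ-zero {k} (suc n) = trans (∑ⱽ-cong n (λ _ → sum-replicate-zero k)) (∑ⱽ-zero n)

∑ⱽ-distrib-+ : ∀ n (f g : Vec (Fin k) n → ℕ) →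
               ∑ⱽ k n (λ xs → f xs + g xs) ≡ ∑ⱽ k n f + ∑ⱽ k n g
∑ⱽ-distrib-+ zero    f g = refl
∑ⱽ-distrib-+ (suc n) f g =
  trans (∑ⱽ-cong n (λ xs → ∑-distrib-+ (λ x → f (x ∷ xs)) (λ x → g (x ∷ xs))))
        (∑ⱽ-distrib-+ n _ _)

*-distribˡ-∑ⱽ : ∀ n c (f : Vec (Fin k) n → ℕ) → c * ∑ⱽ k n f ≡ ∑ⱽ k n (λ xs → c * f xs)
*-distribˡ-∑ⱽ zero    c f = refl
*-distribˡ-∑ⱽ (suc n) c f =
  trans (*-distribˡ-∑ⱽ n c _) (∑ⱽ-cong n (λ xs → *-distribˡ-sum c (λ x → f (x ∷ xs))))

∑ⱽ-∑-comm : ∀ n (h : Fin m → Vec (Fin k) n → ℕ) →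
            ∑ⱽ k n (λ xs → ∑[ i < m ] h i xs) ≡ ∑[ i < m ] ∑ⱽ k n (h i)
∑ⱽ-∑-comm zero    h = refl
∑ⱽ-∑-comm {k = k} (suc n) h =
  trans (∑ⱽ-cong n (λ xs → ∑-comm (λ x i → h i (x ∷ xs)))) (∑ⱽ-∑-comm n (λ i xs → ∑[ x < k ] h i (x ∷ xs)))

∑ⱽ-punchIn : ∀ n (v : Fin (suc m)) (f : Vec (Fin (suc m)) n → ℕ) →
             (∀ xs → v ∈ xs → f xs ≡ 0) →
             ∑ⱽ (suc m) n f ≡ ∑ⱽ m n (f ∘ mapⱽ (punchIn v))
∑ⱽ-punchIn zero    v f f-vanishes = refl
∑ⱽ-punchIn {m} (suc n) v f f-vanishes =
  trans (∑ⱽ-punchIn n v (λ xs → ∑[ x < suc m ] f (x ∷ xs)) row-vanishes)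
        (∑ⱽ-cong n row-punchIn)
  where
  row-punchIn : ∀ ys → ∑[ x < suc m ] f (x ∷ mapⱽ (punchIn v) ys) ≡ ∑[ y < m ] f (mapⱽ (punchIn v) (y ∷ ys))
  row-punchIn ys = trans (sum-remove {i = v} (λ x → f (x ∷ ys′)))
                         (cong (_+ ∑[ y < m ] f (punchIn v y ∷ ys′)) (f-vanishes (v ∷ ys′) (here refl)))
    where ys′ = mapⱽ (punchIn v) ys
  row-vanishes : ∀ xs → v ∈ xs → ∑[ x < suc m ] f (x ∷ xs) ≡ 0
  row-vanishes xs v∈xs = trans (sum-cong-≗ (λ x → f-vanishes (x ∷ xs) (there v∈xs))) (sum-replicate-zero (suc m))

listSum-concatMap : {A B : Set} (g : B → ℕ) (h : A → List B) (xs : List A) →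
                    listSum (map g (concatMap h xs)) ≡ listSum (map (listSum ∘ map g ∘ h) xs)
listSum-concatMap g h []       = refl
listSum-concatMap g h (x ∷ xs) = begin
  listSum (map g (h x ++ concatMap h xs))
    ≡⟨ cong listSum (map-++ g (h x) _) ⟩
  listSum (map g (h x) ++ map g (concatMap h xs))
    ≡⟨ listSum-++ (map g (h x)) _ ⟩
  listSum (map g (h x)) + listSum (map g (concatMap h xs))
    ≡⟨ cong (listSum (map g (h x)) +_) (listSum-concatMap g h xs) ⟩
  listSum (map g (h x)) + listSum (map (listSum ∘ map g ∘ h) xs) ∎
  where open ≡-Reasoning

listSum-tabulate : ∀ k (g : Fin k → ℕ) → listSum (tabulate g) ≡ ∑[ i < k ] g i
listSum-tabulate zero    g = refl
listSum-tabulate (suc k) g = cong (g zero +_) (listSum-tabulate k (g ∘ suc))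

listSum-allSeqs : ∀ k n (f : Vec (Fin k) n → ℕ) → listSum (map f (allSeqs k n)) ≡ ∑ⱽ k n f
listSum-allSeqs k zero    f = +-identityʳ (f [])
listSum-allSeqs k (suc n) f = begin
  listSum (map f (concatMap (λ xs → map (_∷ xs) (allFin k)) (allSeqs k n)))
    ≡⟨ listSum-concatMap f _ (allSeqs k n) ⟩
  listSum (map (λ xs → listSum (map f (map (_∷ xs) (allFin k)))) (allSeqs k n))
    ≡⟨ cong listSum (map-cong sum-row (allSeqs k n)) ⟩
  listSum (map (λ xs → ∑[ x < k ] f (x ∷ xs)) (allSeqs k n))
    ≡⟨ listSum-allSeqs k n _ ⟩
  ∑ⱽ k (suc n) f ∎
  where
  open ≡-Reasoning
  sum-row : ∀ xs → listSum (map f (map (_∷ xs) (allFin k))) ≡ ∑[ x < k ] f (x ∷ xs)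
  sum-row xs = trans (cong (listSum ∘ map f) (map-tabulate id (_∷ xs)))
                     (trans (cong listSum (map-tabulate (_∷ xs) f)) (listSum-tabulate k _))

SurjectiveWalk : Vec (Fin k) n → Set
SurjectiveWalk xs = IsWalk xs × VisitsAll xs

surjectiveWalk? : (xs : Vec (Fin k) n) → Dec (SurjectiveWalk xs)
surjectiveWalk? xs = isWalk? xs ×-dec visitsAll? xs

D≡∑ⱽ : ∀ n k → D n k ≡ ∑ⱽ k n (𝟙 ∘ surjectiveWalk?)
D≡∑ⱽ n k = trans (length-filter surjectiveWalk? (allSeqs k n)) (listSum-allSeqs k n _)

CanPrecede : Fin k → Vec (Fin k) n → Set
CanPrecede x []      = ⊤
CanPrecede x (y ∷ _) = x ≢ y

canPrecede? : (x : Fin k) (xs : Vec (Fin k) n) → Dec (CanPrecede x xs)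
canPrecede? x []      = yes tt
canPrecede? x (y ∷ _) = ¬? (x ≟ y)

VisitsAllBut : Fin k → Vec (Fin k) n → Set
VisitsAllBut {k} v xs = v ∉ xs × ((w : Fin k) → w ≢ v → w ∈ xs)

visitsAllBut? : (v : Fin k) (xs : Vec (Fin k) n) → Dec (VisitsAllBut v xs)
visitsAllBut? v xs = ¬? (any? (v ≟_) xs) ×-dec all? (λ w → ¬? (w ≟ v) →-dec any? (w ≟_) xs)

WalkAvoiding : Fin k → Vec (Fin k) n → Set
WalkAvoiding v xs = IsWalk xs × VisitsAllBut v xs

walkAvoiding? : (v : Fin k) (xs : Vec (Fin k) n) → Dec (WalkAvoiding v xs)
walkAvoiding? v xs = isWalk? xs ×-dec visitsAllBut? v xs

isWalk-∷⁺ : (x : Fin k) (xs : Vec (Fin k) n) → CanPrecede x xs → IsWalk xs → IsWalk (x ∷ xs)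
isWalk-∷⁺ x []      _   _    = tt
isWalk-∷⁺ x (y ∷ _) x≢y walk = x≢y , walk

isWalk-∷⁻ : (x : Fin k) (xs : Vec (Fin k) n) → IsWalk (x ∷ xs) → CanPrecede x xs × IsWalk xs
isWalk-∷⁻ x []      _            = tt , tt
isWalk-∷⁻ x (y ∷ _) (x≢y , walk) = x≢y , walk

∉⇒canPrecede : (x : Fin k) (xs : Vec (Fin k) n) → x ∉ xs → CanPrecede x xs
∉⇒canPrecede x []      _        = tt
∉⇒canPrecede x (y ∷ _) x∉xs x≡y = x∉xs (here x≡y)

surjectiveWalk-∷ : (x : Fin k) (xs : Vec (Fin k) n) →
                   SurjectiveWalk (x ∷ xs) ⇔
                   ((CanPrecede x xs × SurjectiveWalk xs) ⊎ WalkAvoiding x xs)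
surjectiveWalk-∷ x xs = mk⇔ to from
  where
  to : SurjectiveWalk (x ∷ xs) →
       (CanPrecede x xs × SurjectiveWalk xs) ⊎ WalkAvoiding x xs
  to (walk , visits) with isWalk-∷⁻ x xs walk | any? (x ≟_) xs
  ... | x↝xs , walk′ | yes x∈xs = inj₁ (x↝xs , walk′ , visits′)
    where
    visits′ : VisitsAll xs
    visits′ v with visits v
    ... | here v≡x   = subst (_∈ xs) (sym v≡x) x∈xs
    ... | there v∈xs = v∈xs
  ... | _ , walk′ | no x∉xs = inj₂ (walk′ , x∉xs , visits′)
    where
    visits′ : ∀ w → w ≢ x → w ∈ xs
    visits′ w w≢x with visits w
    ... | here w≡x   = contradiction w≡x w≢x
    ... | there w∈xs = w∈xs
  from : (CanPrecede x xs × SurjectiveWalk xs) ⊎ WalkAvoiding x xs →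
         SurjectiveWalk (x ∷ xs)
  from (inj₁ (x↝xs , walk , visits)) = isWalk-∷⁺ x xs x↝xs walk , there ∘ visits
  from (inj₂ (walk , x∉xs , visits)) =
    isWalk-∷⁺ x xs (∉⇒canPrecede x xs x∉xs) walk , visits′
    where
    visits′ : VisitsAll (x ∷ xs)
    visits′ v with v ≟ x
    ... | yes v≡x = here v≡x
    ... | no v≢x  = there (visits v v≢x)

𝟙-surjectiveWalk-[] : ∀ k → 𝟙 (surjectiveWalk? {suc k} []) ≡ 0
𝟙-surjectiveWalk-[] k = 𝟙-no (λ (_ , visits) → notVisited (visits zero)) (surjectiveWalk? [])
  where
  notVisited : zero ∉ ([] {A = Fin (suc k)})
  notVisited ()

∑-canPrecede : (xs : Vec (Fin (suc m)) n) →
               (∑[ x < suc m ] 𝟙 (canPrecede? x xs)) * 𝟙 (surjectiveWalk? xs) ≡ m * 𝟙 (surjectiveWalk? xs)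
∑-canPrecede {m} [] rewrite 𝟙-surjectiveWalk-[] m =
  trans (*-zeroʳ (∑[ x < suc m ] 𝟙 (canPrecede? x []))) (sym (*-zeroʳ m))
∑-canPrecede (y ∷ ys) = cong (_* 𝟙 (surjectiveWalk? (y ∷ ys))) (∑-≢ y)

𝟙-surjectiveWalk-∷ : (x : Fin k) (xs : Vec (Fin k) n) →
                     𝟙 (surjectiveWalk? (x ∷ xs)) ≡
                     𝟙 (canPrecede? x xs) * 𝟙 (surjectiveWalk? xs) + 𝟙 (walkAvoiding? x xs)
𝟙-surjectiveWalk-∷ x xs = begin
  𝟙 (surjectiveWalk? (x ∷ xs))
    ≡⟨ 𝟙-cong (surjectiveWalk-∷ x xs) (surjectiveWalk? (x ∷ xs)) (continuing ⊎-dec avoiding) ⟩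
  𝟙 (continuing ⊎-dec avoiding)
    ≡⟨ 𝟙-⊎ (λ ((_ , _ , visits) , (_ , x∉xs , _)) → x∉xs (visits x)) continuing avoiding ⟩
  𝟙 continuing + 𝟙 avoiding
    ≡⟨ cong (_+ 𝟙 avoiding) (𝟙-× (canPrecede? x xs) (surjectiveWalk? xs)) ⟩
  𝟙 (canPrecede? x xs) * 𝟙 (surjectiveWalk? xs) + 𝟙 avoiding ∎
  where
  open ≡-Reasoning
  continuing = canPrecede? x xs ×-dec surjectiveWalk? xs
  avoiding   = walkAvoiding? x xs

∑-surjectiveWalk-∷ : (xs : Vec (Fin (suc m)) n) →
                     ∑[ x < suc m ] 𝟙 (surjectiveWalk? (x ∷ xs)) ≡
                     m * 𝟙 (surjectiveWalk? xs) + ∑[ x < suc m ] 𝟙 (walkAvoiding? x xs)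
∑-surjectiveWalk-∷ {m} xs = begin
  ∑[ x < suc m ] 𝟙 (surjectiveWalk? (x ∷ xs))
    ≡⟨ sum-cong-≗ (λ x → 𝟙-surjectiveWalk-∷ x xs) ⟩
  ∑[ x < suc m ] (𝟙 (canPrecede? x xs) * χ + 𝟙 (walkAvoiding? x xs))
    ≡⟨ ∑-distrib-+ (λ x → 𝟙 (canPrecede? x xs) * χ) (λ x → 𝟙 (walkAvoiding? x xs)) ⟩
  ∑[ x < suc m ] (𝟙 (canPrecede? x xs) * χ) + ∑avoiding
    ≡⟨ cong (_+ ∑avoiding) (sym (*-distribʳ-sum χ (λ x → 𝟙 (canPrecede? x xs)))) ⟩
  (∑[ x < suc m ] 𝟙 (canPrecede? x xs)) * χ + ∑avoiding
    ≡⟨ cong (_+ ∑avoiding) (∑-canPrecede xs) ⟩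
  m * χ + ∑avoiding ∎
  where
  open ≡-Reasoning
  χ         = 𝟙 (surjectiveWalk? xs)
  ∑avoiding = ∑[ x < suc m ] 𝟙 (walkAvoiding? x xs)

isWalk-map⁺ : (f : Fin m → Fin k) → (∀ {x y} → f x ≡ f y → x ≡ y) →
              (xs : Vec (Fin m) n) → IsWalk xs → IsWalk (mapⱽ f xs)
isWalk-map⁺ f f-inj []           _            = tt
isWalk-map⁺ f f-inj (x ∷ [])     _            = tt
isWalk-map⁺ f f-inj (x ∷ y ∷ xs) (x≢y , walk) = x≢y ∘ f-inj , isWalk-map⁺ f f-inj (y ∷ xs) walk

isWalk-map⁻ : (f : Fin m → Fin k) (xs : Vec (Fin m) n) → IsWalk (mapⱽ f xs) → IsWalk xs
isWalk-map⁻ f []           _              = tt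
isWalk-map⁻ f (x ∷ [])     _              = tt
isWalk-map⁻ f (x ∷ y ∷ xs) (fx≢fy , walk) = fx≢fy ∘ cong f , isWalk-map⁻ f (y ∷ xs) walk

visitsAllBut-punchIn : (v : Fin (suc m)) (ys : Vec (Fin m) n) →
                       VisitsAllBut v (mapⱽ (punchIn v) ys) ⇔ VisitsAll ys
visitsAllBut-punchIn v ys = mk⇔ to from
  where
  to : VisitsAllBut v (mapⱽ (punchIn v) ys) → VisitsAll ys
  to (_ , visits) y = mapᴬ (punchIn-injective v y _) (map⁻ (visits (punchIn v y) (punchInᵢ≢i v y)))
  from : VisitsAll ys → VisitsAllBut v (mapⱽ (punchIn v) ys)
  from visits = v∉ , visits′
    where
    v∉ : v ∉ mapⱽ (punchIn v) ys
    v∉ v∈ = let (y , v≡y′) = satisfied (map⁻ v∈) in punchInᵢ≢i v y (sym v≡y′)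
    visits′ : ∀ w → w ≢ v → w ∈ mapⱽ (punchIn v) ys
    visits′ w w≢v = subst (_∈ _) (punchIn-punchOut (w≢v ∘ sym)) (∈-map⁺ (punchIn v) (visits _))

∑ⱽ-walkAvoiding : ∀ n (v : Fin (suc m)) →
                  ∑ⱽ (suc m) n (λ xs → 𝟙 (walkAvoiding? v xs)) ≡ ∑ⱽ m n (𝟙 ∘ surjectiveWalk?)
∑ⱽ-walkAvoiding n v =
  trans (∑ⱽ-punchIn n v _ (λ xs v∈xs → 𝟙-no (λ (_ , v∉xs , _) → v∉xs v∈xs) _))
        (∑ⱽ-cong n (λ ys → 𝟙-cong (relabel ys) _ _))
  where
  relabel : ∀ ys → WalkAvoiding v (mapⱽ (punchIn v) ys) ⇔ SurjectiveWalk ys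
  relabel ys = mk⇔
    (λ (walk , visits) → isWalk-map⁻ _ ys walk , Equivalence.to (visitsAllBut-punchIn v ys) visits)
    (λ (walk , visits) → isWalk-map⁺ _ (punchIn-injective v _ _) ys walk
                       , Equivalence.from (visitsAllBut-punchIn v ys) visits)

D-suc : ∀ n m → D (suc n) (suc m) ≡ m * D n (suc m) + suc m * D n m
D-suc n m = begin
  D (suc n) (suc m)
    ≡⟨ D≡∑ⱽ (suc n) (suc m) ⟩
  ∑ⱽ (suc m) n (λ xs → ∑[ x < suc m ] χ (x ∷ xs))
    ≡⟨ ∑ⱽ-cong n ∑-surjectiveWalk-∷ ⟩
  ∑ⱽ (suc m) n (λ xs → m * χ xs + ∑[ x < suc m ] avoiding x xs)
    ≡⟨ ∑ⱽ-distrib-+ n (λ xs → m * χ xs) (λ xs → ∑[ x < suc m ] avoiding x xs) ⟩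
  ∑ⱽ (suc m) n (λ xs → m * χ xs) + ∑ⱽ (suc m) n (λ xs → ∑[ x < suc m ] avoiding x xs)
    ≡⟨ cong₂ _+_ (sym (*-distribˡ-∑ⱽ n m χ)) (∑ⱽ-∑-comm n avoiding) ⟩
  m * ∑ⱽ (suc m) n χ + ∑[ x < suc m ] ∑ⱽ (suc m) n (avoiding x)
    ≡⟨ cong (m * ∑ⱽ (suc m) n χ +_) (sum-cong-≗ (∑ⱽ-walkAvoiding n)) ⟩
  m * ∑ⱽ (suc m) n χ + ∑[ _ < suc m ] ∑ⱽ m n χ
    ≡⟨ cong (m * ∑ⱽ (suc m) n χ +_) (∑-const (suc m) (∑ⱽ m n χ)) ⟩
  m * ∑ⱽ (suc m) n χ + suc m * ∑ⱽ m n χ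
    ≡⟨ sym (cong₂ (λ a b → m * a + suc m * b) (D≡∑ⱽ n (suc m)) (D≡∑ⱽ n m)) ⟩
  m * D n (suc m) + suc m * D n m ∎
  where
  open ≡-Reasoning
  χ : ∀ {k n} → Vec (Fin k) n → ℕ
  χ = 𝟙 ∘ surjectiveWalk?
  avoiding : Fin (suc m) → Vec (Fin (suc m)) n → ℕ
  avoiding x xs = 𝟙 (walkAvoiding? x xs)

D-zero-suc : ∀ k → D 0 (suc k) ≡ 0
D-zero-suc k = trans (D≡∑ⱽ 0 (suc k)) (𝟙-surjectiveWalk-[] k)

D-suc-zero : ∀ n → D (suc n) 0 ≡ 0
D-suc-zero n = trans (D≡∑ⱽ (suc n) 0) (∑ⱽ-zero n)

D-vanishes : ∀ n k → n < k → D n k ≡ 0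
D-vanishes zero    (suc k) _         = D-zero-suc k
D-vanishes (suc n) (suc m) (s≤s n<m) = begin
  D (suc n) (suc m)                ≡⟨ D-suc n m ⟩
  m * D n (suc m) + suc m * D n m  ≡⟨ cong₂ (λ a b → m * a + suc m * b) (D-vanishes n (suc m) (m≤n⇒m≤1+n n<m)) (D-vanishes n m n<m) ⟩
  m * 0 + suc m * 0                ≡⟨ cong₂ _+_ (*-zeroʳ m) (*-zeroʳ (suc m)) ⟩
  0                                ∎
  where open ≡-Reasoning

D-diagonal : ∀ n → D n n ≡ n !
D-diagonal zero    = refl
D-diagonal (suc n) = begin
  D (suc n) (suc n)                ≡⟨ D-suc n n ⟩
  n * D n (suc n) + suc n * D n n  ≡⟨ cong₂ (λ a b → n * a + suc n * b) (D-vanishes n (suc n) ≤-refl) (D-diagonal n) ⟩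
  n * 0 + suc n * n !              ≡⟨ cong (_+ suc n * n !) (*-zeroʳ n) ⟩
  suc n !                          ∎
  where open ≡-Reasoning

-- 0 * D (suc n) 1 + 1 * D (suc n) 0 normalises to D (suc n) 0 + 0.
D-one : ∀ n → 1 < n → D n 1 ≡ 0
D-one (suc zero)    (s≤s ())
D-one (suc (suc n)) _ = trans (D-suc (suc n) 0) (trans (+-identityʳ _) (D-suc-zero n))

mainTheorem3 :
    ((n k : ℕ) → 2 ≤ k → k ≤ n →
      D n k ≡ (k ∸ 1) * D (n ∸ 1) k + k * D (n ∸ 1) (k ∸ 1))
    × ((n : ℕ) → D n n ≡ n !)
    × ((n : ℕ) → 1 < n → D n 1 ≡ 0)
    × ((n k : ℕ) → n < k → D n k ≡ 0)
mainTheorem3 = recurrence , D-diagonal , D-one , D-vanishes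
  where
  recurrence : (n k : ℕ) → 2 ≤ k → k ≤ n → D n k ≡ (k ∸ 1) * D (n ∸ 1) k + k * D (n ∸ 1) (k ∸ 1)
  recurrence (suc n) (suc m) _ _ = D-suc n m
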